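{- Let $m\ge1$ and $l\ge1$ be integers, $k\in\{0,1,\dots,m\}$, and let $B^*_{k,0}(t)$ be as defined in the context. Then \[ \left( \prod_{\substack{p\le m\\ p \text{ prime}}} p^{\left\lfloor \frac{m}{p}\right\rfloor v_p(l!) - v_p(l)} \right)^{ -1} B^*_{k,0}(t) \in \mathbb Z[t]. \]
   Context: $v_p$ denotes the $p$-adic valuation. For $k\in\{0,\dots,m\}$ let $l^{(k)}_i=l$ for $i\ne k$ and $l^{(k)}_k=l-1$ ($i=0,\dots,m$), and $L=(m+1)l-1$. For $j\in\{0,\dots,m\}$ define $\sigma^{(k,j)}_i$ by $\prod_{i=0}^m(i-j-w)^{l^{(k)}_i}=\sum_{i=0}^L\sigma^{(k,j)}_i w^i$ and \[ B^*_{k,j}(t)=\frac{1}{(l-1)!}\sum_{i=0}^{L} i!\,\sigma^{(k,j)}_i\,t^{L-i} \] (equivalently $B^*_{k,j}(t)=\frac{t^{L+1}}{(l-1)!}\int_0^\infty e^{ -yt}\prod_{i=0}^m(i-j-y)^{l^{(k)}_i}\,dy$ for $t>0$). -}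

module Defs where

open import Data.Nat as ℕ using (ℕ; zero; suc; _∸_; _≤_; _^_; _!)
open import Data.Nat.DivMod using (_/_)
open import Data.Nat.Divisibility using (_∣?_)
open import Data.Nat.Primality using (prime?)

open import Data.Integer as ℤ using (ℤ; +_; -_)
open import Data.List using (List; []; _∷_; map; upTo; foldr)
open import Relation.Nullary.Decidable using (does)
open import Data.Bool using (if_then_else_)

-- p-adic valuation v_p(n) on ℕ (for n > 0; v_p(0) := 0, v_p(n) := 0 for p < 2).

private
  vLoop : ℕ → (q : ℕ) → ℕ → ℕ
  -- fuel, q (p = q + 2), n
  vLoop zero    q n       = 0
  vLoop (suc f) q zero    = 0
  vLoop (suc f) q (suc n) =
    if does (suc (suc q) ∣? suc n)
    then suc (vLoop f q (suc n / suc (suc q)))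
    else 0

v : ℕ → ℕ → ℕ
v zero          n = 0
v (suc zero)    n = 0
v (suc (suc q)) n = vLoop n q n

-- Prefactor  ∏_{p ≤ m, p prime} p ^ (⌊m/p⌋ v_p(l!) - v_p(l)).
-- (The exponent is always ≥ 0 since ⌊m/p⌋ ≥ 1 and l ∣ l!, so ∸ is exact.)

primeFactor : ℕ → ℕ → ℕ → ℕ
primeFactor m l zero    = 1
primeFactor m l (suc q) =
  if does (prime? (suc q))
  then suc q ^ ((m / suc q ℕ.* v (suc q) (l !)) ∸ v (suc q) l)
  else 1

primeProduct : ℕ → ℕ → ℕ
primeProduct m l = foldr ℕ._*_ 1 (map (primeFactor m l) (upTo (suc m)))

-- Integer polynomials as coefficient lists, lowest degree first.

Poly : Set
Poly = List ℤ

addP : Poly → Poly → Poly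
addP []       q        = q
addP (a ∷ p)  []       = a ∷ p
addP (a ∷ p)  (b ∷ q)  = (a ℤ.+ b) ∷ addP p q

mulP : Poly → Poly → Poly
mulP []      q = []
mulP (a ∷ p) q = addP (map (a ℤ.*_) q) (+ 0 ∷ mulP p q)

powP : Poly → ℕ → Poly
powP p zero    = + 1 ∷ []
powP p (suc n) = mulP p (powP p n)

coeff : Poly → ℕ → ℤ
coeff []      _       = + 0
coeff (a ∷ p) zero    = a
coeff (a ∷ p) (suc i) = coeff p i

lk : ℕ → ℕ → ℕ → ℕ
lk l k i = if does (i ℕ.≟ k) then l ∸ 1 else l

L : ℕ → ℕ → ℕ
L m l = suc m ℕ.* l ∸ 1

sigmaPoly : (m l k j : ℕ) → Poly
sigmaPoly m l k j =
  foldr mulP (+ 1 ∷ [])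
    (map (λ i → powP ((+ i ℤ.- + j) ∷ - + 1 ∷ []) (lk l k i)) (upTo (suc m)))

σ : (m l k j i : ℕ) → ℤ
σ m l k j i = coeff (sigmaPoly m l k j) i

-- (l-1)! · B*_{k,j}(t) = Σ_{i=0}^{L} i! σ^{(k,j)}_i t^{L-i};
-- this is the integer numerator of the coefficient of t^{L-i} in B*_{k,j}(t).
BstarNum : (m l k j i : ℕ) → ℤ
BstarNum m l k j i = + (i !) ℤ.* σ m l k j i

{-# OPTIONS --safe #-}
-- Say N ∣ʰ c when N divides i! c_i for every i, i.e. all coefficients of the Hurwitz series of c.
-- Since i! (c d)_i = Σ_j (i choose j) (j! c_j) ((i-j)! d_(i-j)), this property is multiplicative,
-- so i! σ_i is divisible by any product of weights N_i with N_i ∣ʰ (i - w)^(l_i). The factor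
-- (-w)^n admits N = n!, and for a prime p dividing b the factor (b - w)^n admits p^(v_p(n!)),
-- because its Hurwitz coefficients are ±n!/(n-j)! b^(n-j) and v_p(n!) ≤ n. Over the ⌊m/p⌋
-- multiples of p in 1..m this collects the exponent ⌊m/p⌋ v_p(l!), up to a loss of v_p(l) at
-- i = k, where v_p(l!) ≤ v_p((l-1)!) + v_p(l). Prime powers of distinct primes are coprime, so
-- (l-1)! times their product divides i! σ_i as well.
module Submission where

open import Defs

open import Data.Bool using (if_then_else_)
open import Data.Empty using (⊥-elim)
open import Data.List using ([]; _∷_; _++_; map; foldr; applyUpTo; upTo)
open import Data.Nat using (ℕ; zero; suc; NonZero; _!)
open import Data.Product using (∃-syntax; _×_; _,_)
open import Function using (_∘_)
open import Relation.Binary.PropositionalEquality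

module Polynomials where

  open import Data.Integer using (ℤ; +_; -_; _+_; _*_)
  open import Data.Integer.Properties
    using (+-identityˡ; +-identityʳ; *-zeroʳ; *-distribʳ-+; neg-distribˡ-*; pos-*)
  open import Data.Integer.Tactic.RingSolver using (solve-∀)
  open import Data.Nat as ℕ using ()
  open ≡-Reasoning

  conv : (ℕ → ℤ) → (ℕ → ℤ) → ℕ → ℤ
  conv c d zero    = c 0 * d 0
  conv c d (suc i) = c 0 * d (suc i) + conv (c ∘ suc) d i

  ∂ : (ℕ → ℤ) → ℕ → ℤ
  ∂ c i = + suc i * c (suc i)

  conv-congˡ : ∀ {c e} d → (∀ j → c j ≡ e j) → ∀ i → conv c d i ≡ conv e d i
  conv-congˡ d c≗e zero    = cong (_* d 0) (c≗e 0)
  conv-congˡ d c≗e (suc i) =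
    cong₂ (λ x y → x * d (suc i) + y) (c≗e 0) (conv-congˡ d (c≗e ∘ suc) i)

  conv-congʳ : ∀ c {d e} → (∀ j → d j ≡ e j) → ∀ i → conv c d i ≡ conv c e i
  conv-congʳ c d≗e zero    = cong (c 0 *_) (d≗e 0)
  conv-congʳ c d≗e (suc i) =
    cong₂ (λ x y → c 0 * x + y) (d≗e (suc i)) (conv-congʳ (c ∘ suc) d≗e i)

  conv-+ˡ : ∀ c e d i → conv (λ j → c j + e j) d i ≡ conv c d i + conv e d i
  conv-+ˡ c e d zero    = *-distribʳ-+ (d 0) (c 0) (e 0)
  conv-+ˡ c e d (suc i) = begin
    (c 0 + e 0) * d (suc i) + conv (λ j → c (suc j) + e (suc j)) d i
      ≡⟨ cong (_+_ ((c 0 + e 0) * d (suc i))) (conv-+ˡ (c ∘ suc) (e ∘ suc) d i) ⟩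
    (c 0 + e 0) * d (suc i) + (conv (c ∘ suc) d i + conv (e ∘ suc) d i)
      ≡⟨ regroup (c 0) (e 0) (d (suc i)) _ _ ⟩
    c 0 * d (suc i) + conv (c ∘ suc) d i + (e 0 * d (suc i) + conv (e ∘ suc) d i) ∎
    where
    regroup : ∀ a b x y z → (a + b) * x + (y + z) ≡ a * x + y + (b * x + z)
    regroup = solve-∀

  conv-*ʳ : ∀ c d a i → conv c (λ j → a * d j) i ≡ a * conv c d i
  conv-*ʳ c d a zero    = swap (c 0) a (d 0)
    where
    swap : ∀ x a y → x * (a * y) ≡ a * (x * y)
    swap = solve-∀
  conv-*ʳ c d a (suc i) = begin
    c 0 * (a * d (suc i)) + conv (c ∘ suc) (λ j → a * d j) i
      ≡⟨ cong (_+_ (c 0 * (a * d (suc i)))) (conv-*ʳ (c ∘ suc) d a i) ⟩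
    c 0 * (a * d (suc i)) + a * conv (c ∘ suc) d i
      ≡⟨ factor (c 0) a (d (suc i)) _ ⟩
    a * (c 0 * d (suc i) + conv (c ∘ suc) d i) ∎
    where
    factor : ∀ x a y z → x * (a * y) + a * z ≡ a * (x * y + z)
    factor = solve-∀

  conv-zeroˡ : ∀ {c} d → (∀ j → c j ≡ + 0) → ∀ i → conv c d i ≡ + 0
  conv-zeroˡ d c≗0 zero    = cong (_* d 0) (c≗0 0)
  conv-zeroˡ d c≗0 (suc i) =
    cong₂ (λ x y → x * d (suc i) + y) (c≗0 0) (conv-zeroˡ d (c≗0 ∘ suc) i)

  conv-zeroʳ : ∀ c {d} → (∀ j → d j ≡ + 0) → ∀ i → conv c d i ≡ + 0
  conv-zeroʳ c d≗0 zero    = trans (cong (c 0 *_) (d≗0 0)) (*-zeroʳ (c 0))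
  conv-zeroʳ c d≗0 (suc i) = cong₂ _+_ (trans (cong (c 0 *_) (d≗0 (suc i))) (*-zeroʳ (c 0)))
                                       (conv-zeroʳ (c ∘ suc) d≗0 i)

  conv-constˡ : ∀ {c} d → (∀ j → c (suc j) ≡ + 0) → ∀ i → conv c d i ≡ c 0 * d i
  conv-constˡ     d c≗0 zero    = refl
  conv-constˡ {c} d c≗0 (suc i) =
    trans (cong (_+_ (c 0 * d (suc i))) (conv-zeroˡ d c≗0 i)) (+-identityʳ _)

  ∂-conv : ∀ c d i → ∂ (conv c d) i ≡ conv (∂ c) d i + conv c (∂ d) i
  ∂-conv c d zero = expand (c 0) (c 1) (d 0) (d 1)
    where
    expand : ∀ a b x y → + 1 * (a * y + b * x) ≡ (+ 1 * b) * x + a * (+ 1 * y)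
    expand = solve-∀
  ∂-conv c d (suc i) = begin
    (+ 1 + n) * (c 0 * d₂ + conv c₁ d (suc i))
      ≡⟨ expand n (c 0) d₂ (conv c₁ d (suc i)) ⟩
    c 0 * ((+ 1 + n) * d₂) + (∂ (conv c₁ d) i + conv c₁ d (suc i))
      ≡⟨ cong (λ x → c 0 * ((+ 1 + n) * d₂) + (x + conv c₁ d (suc i))) (∂-conv c₁ d i) ⟩
    c 0 * ((+ 1 + n) * d₂) + (conv (∂ c₁) d i + conv c₁ (∂ d) i + (c 1 * d₁ + conv c₂ d i))
      ≡⟨ regroup (c 0 * ((+ 1 + n) * d₂)) (conv (∂ c₁) d i) (conv c₁ (∂ d) i) (c 1) d₁ (conv c₂ d i) ⟩
    ∂ c 0 * d₁ + (conv (∂ c₁) d i + conv c₂ d i) + (c 0 * ((+ 1 + n) * d₂) + conv c₁ (∂ d) i)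
      ≡⟨ cong (λ x → ∂ c 0 * d₁ + x + (c 0 * ((+ 1 + n) * d₂) + conv c₁ (∂ d) i)) (sym ∂c₁) ⟩
    ∂ c 0 * d₁ + conv (∂ c ∘ suc) d i + (c 0 * ∂ d (suc i) + conv c₁ (∂ d) i) ∎
    where
    n  = + suc i
    c₁ = c ∘ suc
    c₂ = c ∘ suc ∘ suc
    d₁ = d (suc i)
    d₂ = d (suc (suc i))
    expand : ∀ n a x z → (+ 1 + n) * (a * x + z) ≡ a * ((+ 1 + n) * x) + (n * z + z)
    expand = solve-∀
    regroup : ∀ a x y b e w → a + (x + y + (b * e + w)) ≡ (+ 1 * b) * e + (x + w) + (a + y)
    regroup = solve-∀
    unfold : ∀ n x → (+ 1 + n) * x ≡ n * x + x
    unfold = solve-∀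
    ∂c₁ : conv (∂ c ∘ suc) d i ≡ conv (∂ c₁) d i + conv c₂ d i
    ∂c₁ = trans (conv-congˡ d (λ j → unfold (+ suc j) (c₂ j)) i) (conv-+ˡ (∂ c₁) c₂ d i)

  coeff-addP : ∀ p q i → coeff (addP p q) i ≡ coeff p i + coeff q i
  coeff-addP []      q       i       = sym (+-identityˡ _)
  coeff-addP (a ∷ p) []      zero    = sym (+-identityʳ a)
  coeff-addP (a ∷ p) []      (suc i) = sym (+-identityʳ _)
  coeff-addP (a ∷ p) (b ∷ q) zero    = refl
  coeff-addP (a ∷ p) (b ∷ q) (suc i) = coeff-addP p q i

  coeff-scale : ∀ a q i → coeff (map (a *_) q) i ≡ a * coeff q i
  coeff-scale a []      i       = sym (*-zeroʳ a)
  coeff-scale a (b ∷ q) zero    = refl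
  coeff-scale a (b ∷ q) (suc i) = coeff-scale a q i

  coeff-mulP : ∀ p q i → coeff (mulP p q) i ≡ conv (coeff p) (coeff q) i
  coeff-mulP []      q zero    = refl
  coeff-mulP []      q (suc i) = trans (coeff-mulP [] q i) (sym (+-identityˡ _))
  coeff-mulP (a ∷ p) q zero    =
    trans (coeff-addP (map (a *_) q) _ 0) (trans (+-identityʳ _) (coeff-scale a q 0))
  coeff-mulP (a ∷ p) q (suc i) =
    trans (coeff-addP (map (a *_) q) _ (suc i)) (cong₂ _+_ (coeff-scale a q (suc i)) (coeff-mulP p q i))

  ∂-coeff-mulP : ∀ p q i →
    ∂ (coeff (mulP p q)) i ≡ conv (∂ (coeff p)) (coeff q) i + conv (coeff p) (∂ (coeff q)) i
  ∂-coeff-mulP p q i = trans (cong (+ suc i *_) (coeff-mulP p q (suc i))) (∂-conv _ _ i)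

  lin : ℤ → Poly
  lin b = b ∷ - + 1 ∷ []

  coeff-linPow-0 : ∀ b n → coeff (powP (lin (+ b)) n) 0 ≡ + (b ℕ.^ n)
  coeff-linPow-0 b zero    = refl
  coeff-linPow-0 b (suc n) = begin
    coeff (mulP (lin (+ b)) (powP (lin (+ b)) n)) 0 ≡⟨ coeff-mulP (lin (+ b)) (powP (lin (+ b)) n) 0 ⟩
    + b * coeff (powP (lin (+ b)) n) 0              ≡⟨ cong (+ b *_) (coeff-linPow-0 b n) ⟩
    + b * + (b ℕ.^ n)                               ≡⟨ pos-* b _ ⟨
    + (b ℕ.^ suc n)                                 ∎

  ∂-mulP-lin : ∀ b q i →
    ∂ (coeff (mulP (lin b) q)) i ≡ - coeff q i + conv (coeff (lin b)) (∂ (coeff q)) i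
  ∂-mulP-lin b q i = begin
    ∂ (coeff (mulP (lin b) q)) i
      ≡⟨ ∂-coeff-mulP (lin b) q i ⟩
    conv (∂ (coeff (lin b))) (coeff q) i + conv (coeff (lin b)) (∂ (coeff q)) i
      ≡⟨ cong (_+ r) (conv-constˡ (coeff q) (λ j → *-zeroʳ (+ suc (suc j))) i) ⟩
    (+ 1 * - + 1) * coeff q i + conv (coeff (lin b)) (∂ (coeff q)) i
      ≡⟨ cong (_+ r) (minus-one (coeff q i)) ⟩
    - coeff q i + conv (coeff (lin b)) (∂ (coeff q)) i ∎
    where
    r = conv (coeff (lin b)) (∂ (coeff q)) i
    minus-one : ∀ x → (+ 1 * - + 1) * x ≡ - x
    minus-one = solve-∀

  ∂-linPow : ∀ b n i → ∂ (coeff (powP (lin b) (suc n))) i ≡ - (+ suc n * coeff (powP (lin b) n) i)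
  ∂-linPow b zero i = begin
    ∂ (coeff (mulP (lin b) (+ 1 ∷ []))) i ≡⟨ ∂-mulP-lin b (+ 1 ∷ []) i ⟩
    - c + conv (coeff (lin b)) (∂ (coeff (+ 1 ∷ []))) i
      ≡⟨ cong (_+_ (- c)) (conv-zeroʳ (coeff (lin b)) (λ j → *-zeroʳ (+ suc j)) i) ⟩
    - c + + 0 ≡⟨ tidy c ⟩
    - (+ 1 * c) ∎
    where
    c = coeff (+ 1 ∷ []) i
    tidy : ∀ x → - x + + 0 ≡ - (+ 1 * x)
    tidy = solve-∀
  ∂-linPow b (suc n) i = begin
    ∂ (coeff (mulP (lin b) q)) i                       ≡⟨ ∂-mulP-lin b q i ⟩
    - coeff q i + conv (coeff (lin b)) (∂ (coeff q)) i ≡⟨ cong (_+_ (- coeff q i)) lin-∂q ⟩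
    - coeff q i + - + suc n * coeff q i                ≡⟨ collect (+ suc n) (coeff q i) ⟩
    - ((+ 1 + + suc n) * coeff q i)                    ∎
    where
    q = powP (lin b) (suc n)
    qₙ = coeff (powP (lin b) n)
    collect : ∀ n x → - x + - n * x ≡ - ((+ 1 + n) * x)
    collect = solve-∀
    lin-∂q : conv (coeff (lin b)) (∂ (coeff q)) i ≡ - + suc n * coeff q i
    lin-∂q = begin
      conv (coeff (lin b)) (∂ (coeff q)) i
        ≡⟨ conv-congʳ (coeff (lin b)) (λ j → trans (∂-linPow b n j) (neg-distribˡ-* (+ suc n) (qₙ j))) i ⟩
      conv (coeff (lin b)) (λ j → - + suc n * qₙ j) i
        ≡⟨ conv-*ʳ (coeff (lin b)) qₙ (- + suc n) i ⟩
      - + suc n * conv (coeff (lin b)) qₙ i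
        ≡⟨ cong (- + suc n *_) (coeff-mulP (lin b) (powP (lin b) n) i) ⟨
      - + suc n * coeff q i ∎

module HurwitzDivisibility where

  open Polynomials
  open import Data.Integer using (ℤ; +_; -_; _+_; _*_)
  open import Data.Integer.Properties using (*-identityˡ; *-assoc; *-distribˡ-+; neg-distribʳ-*; pos-*)
  open import Data.Integer.Divisibility.Signed
    using (∣ᵤ⇒∣; ∣m∣n⇒∣m+n; ∣m⇒∣-m; *-monoʳ-∣; *-monoˡ-∣)
    renaming (_∣_ to _∣ᶻ_; ∣-trans to ∣ᶻ-trans)
  open import Data.Integer.Tactic.RingSolver using (solve-∀)
  open import Data.Nat as ℕ using ()
  open import Data.Nat.Divisibility using (_∣_; 1∣_)
  open import Data.Nat.ListAction using (product)
  import Data.Nat.Properties as ℕ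
  open ≡-Reasoning

  infix 4 _∣ʰ_
  _∣ʰ_ : ℕ → (ℕ → ℤ) → Set
  N ∣ʰ c = ∀ i → + N ∣ᶻ + (i !) * c i

  ∣ʰ-cong : ∀ {N c d} → (∀ i → c i ≡ d i) → N ∣ʰ c → N ∣ʰ d
  ∣ʰ-cong {N} c≗d N∣ʰc i = subst (λ x → + N ∣ᶻ + (i !) * x) (c≗d i) (N∣ʰc i)

  ∣-∣ʰ-trans : ∀ {M N c} → M ∣ N → N ∣ʰ c → M ∣ʰ c
  ∣-∣ʰ-trans M∣N N∣ʰc i = ∣ᶻ-trans (∣ᵤ⇒∣ M∣N) (N∣ʰc i)

  1∣ʰ : ∀ c → 1 ∣ʰ c
  1∣ʰ c i = ∣ᵤ⇒∣ (1∣ _)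

  factorial-∂ : ∀ c i → + (suc i !) * c (suc i) ≡ + (i !) * ∂ c i
  factorial-∂ c i = begin
    + (suc i !) * c (suc i)       ≡⟨ cong (_* c (suc i)) (cong +_ (ℕ.*-comm (suc i) (i !))) ⟩
    + (i ! ℕ.* suc i) * c (suc i) ≡⟨ cong (_* c (suc i)) (pos-* (i !) (suc i)) ⟩
    + (i !) * + suc i * c (suc i) ≡⟨ *-assoc (+ (i !)) (+ suc i) (c (suc i)) ⟩
    + (i !) * ∂ c i               ∎

  ∣ʰ-∂ : ∀ {N c} → N ∣ʰ c → N ∣ʰ ∂ c
  ∣ʰ-∂ {N} {c} N∣ʰc i = subst (+ N ∣ᶻ_) (factorial-∂ c i) (N∣ʰc (suc i))

  ∣ʰ-intro : ∀ {N c} → + N ∣ᶻ c 0 → N ∣ʰ ∂ c → N ∣ʰ c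
  ∣ʰ-intro {N} {c} N∣c₀ N∣ʰ∂c zero    = subst (+ N ∣ᶻ_) (sym (*-identityˡ (c 0))) N∣c₀
  ∣ʰ-intro {N} {c} N∣c₀ N∣ʰ∂c (suc i) = subst (+ N ∣ᶻ_) (sym (factorial-∂ c i)) (N∣ʰ∂c i)

  ∣ʰ-scale : ∀ {N c} a → N ∣ʰ c → a ℕ.* N ∣ʰ (λ i → + a * c i)
  ∣ʰ-scale {N} {c} a N∣ʰc i =
    subst₂ _∣ᶻ_ (sym (pos-* a N)) (swap (+ a) (+ (i !)) (c i)) (*-monoʳ-∣ (+ a) (N∣ʰc i))
    where
    swap : ∀ a f x → a * (f * x) ≡ f * (a * x)
    swap = solve-∀

  ∣ʰ-neg : ∀ {N c} → N ∣ʰ c → N ∣ʰ (λ i → - c i)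
  ∣ʰ-neg {N} {c} N∣ʰc i = subst (+ N ∣ᶻ_) (neg-distribʳ-* (+ (i !)) (c i)) (∣m⇒∣-m (N∣ʰc i))

  ∣ʰ-conv : ∀ {M N c d} → M ∣ʰ c → N ∣ʰ d → M ℕ.* N ∣ʰ conv c d
  ∣ʰ-conv {M} {N} {c} {d} M∣ʰc N∣ʰd zero =
    subst₂ _∣ᶻ_ (sym (pos-* M N)) (units (c 0) (d 0))
      (∣ᶻ-trans (*-monoˡ-∣ (+ N) (M∣ʰc 0)) (*-monoʳ-∣ (+ 1 * c 0) (N∣ʰd 0)))
    where
    units : ∀ x y → (+ 1 * x) * (+ 1 * y) ≡ + 1 * (x * y)
    units = solve-∀
  ∣ʰ-conv {M} {N} {c} {d} M∣ʰc N∣ʰd (suc i) =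
    subst (+ (M ℕ.* N) ∣ᶻ_) (sym leibniz)
      (∣m∣n⇒∣m+n (∣ʰ-conv (∣ʰ-∂ M∣ʰc) N∣ʰd i) (∣ʰ-conv M∣ʰc (∣ʰ-∂ N∣ʰd) i))
    where
    leibniz : + (suc i !) * conv c d (suc i) ≡ + (i !) * conv (∂ c) d i + + (i !) * conv c (∂ d) i
    leibniz = begin
      + (suc i !) * conv c d (suc i)                  ≡⟨ factorial-∂ (conv c d) i ⟩
      + (i !) * ∂ (conv c d) i                        ≡⟨ cong (+ (i !) *_) (∂-conv c d i) ⟩
      + (i !) * (conv (∂ c) d i + conv c (∂ d) i)     ≡⟨ *-distribˡ-+ (+ (i !)) _ _ ⟩
      + (i !) * conv (∂ c) d i + + (i !) * conv c (∂ d) i ∎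

  ∣ʰ-mulP : ∀ {M N} p q → M ∣ʰ coeff p → N ∣ʰ coeff q → M ℕ.* N ∣ʰ coeff (mulP p q)
  ∣ʰ-mulP p q M∣ʰp N∣ʰq = ∣ʰ-cong (λ i → sym (coeff-mulP p q i)) (∣ʰ-conv M∣ʰp N∣ʰq)

  ∣ʰ-product : ∀ {A : Set} (G : A → ℕ) (F : A → Poly) → (∀ x → G x ∣ʰ coeff (F x)) →
    ∀ xs → product (map G xs) ∣ʰ coeff (foldr mulP (+ 1 ∷ []) (map F xs))
  ∣ʰ-product G F G∣ʰF []       = 1∣ʰ _
  ∣ʰ-product G F G∣ʰF (x ∷ xs) = ∣ʰ-mulP (F x) _ (G∣ʰF x) (∣ʰ-product G F G∣ʰF xs)

  ∣ʰ-linPow : ∀ b (N : ℕ → ℕ) → (∀ n → N n ∣ b ℕ.^ n) → (∀ n → N (suc n) ∣ suc n ℕ.* N n) →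
    ∀ n → N n ∣ʰ coeff (powP (lin (+ b)) n)
  ∣ʰ-linPow b N N∣bⁿ N-step zero    = ∣-∣ʰ-trans (N∣bⁿ 0) (1∣ʰ _)
  ∣ʰ-linPow b N N∣bⁿ N-step (suc n) =
    ∣ʰ-intro (subst (+ N (suc n) ∣ᶻ_) (sym (coeff-linPow-0 b (suc n))) (∣ᵤ⇒∣ (N∣bⁿ (suc n))))
      (∣ʰ-cong (λ i → sym (∂-linPow (+ b) n i))
        (∣-∣ʰ-trans (N-step n) (∣ʰ-neg (∣ʰ-scale (suc n) (∣ʰ-linPow b N N∣bⁿ N-step n)))))

module Division {d} .{{_ : NonZero d}} where

  open import Data.Nat
  open import Data.Nat.Properties
  open import Data.Nat.DivMod
  open import Data.Nat.Divisibility
  open import Data.Sum using (inj₁; inj₂)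
  open import Relation.Nullary using (¬_)
  open ≤-Reasoning

  /-unique : ∀ s q → s < d → (s + q * d) / d ≡ q
  /-unique s q s<d = begin-equality
    (s + q * d) / d     ≡⟨ +-distrib-/ s (q * d) remainders<d ⟩
    s / d + q * d / d   ≡⟨ cong₂ _+_ (m<n⇒m/n≡0 s<d) (m*n/n≡m q d) ⟩
    q                   ∎
    where
    remainders<d : s % d + q * d % d < d
    remainders<d = subst (_< d)
      (sym (trans (cong₂ _+_ (m<n⇒m%n≡m s<d) (m*n%n≡0 q d)) (+-identityʳ s))) s<d

  private
    suc-split : ∀ r → suc r ≡ suc (r % d) + r / d * d
    suc-split r = cong suc (m≡m%n+[m/n]*n r d)

  suc-/-∣ : ∀ r → d ∣ suc r → suc r / d ≡ suc (r / d)
  suc-/-∣ r d∣1+r with m≤n⇒m<n∨m≡n (m%n<n r d)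
  ... | inj₁ 1+r%d<d = ⊥-elim (<⇒≱ 1+r%d<d (∣⇒≤ d∣1+r%d))
    where
    d∣1+r%d : d ∣ suc (r % d)
    d∣1+r%d = ∣m+n∣m⇒∣n (subst (d ∣_) (trans (suc-split r) (+-comm (suc (r % d)) _)) d∣1+r)
                           (n∣m*n (r / d))
  ... | inj₂ 1+r%d≡d = trans (cong (_/ d) (trans (suc-split r) (cong (_+ r / d * d) 1+r%d≡d)))
                             (m*n/n≡m (suc (r / d)) d)

  suc-/-∤ : ∀ r → ¬ d ∣ suc r → suc r / d ≡ r / d
  suc-/-∤ r d∤1+r with m≤n⇒m<n∨m≡n (m%n<n r d)
  ... | inj₁ 1+r%d<d = trans (cong (_/ d) (suc-split r)) (/-unique (suc (r % d)) (r / d) 1+r%d<d)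
  ... | inj₂ 1+r%d≡d = ⊥-elim (d∤1+r (divides (suc (r / d))
                                (trans (suc-split r) (cong (_+ r / d * d) 1+r%d≡d))))

module Sums where

  open import Data.Nat
  open import Data.Nat.Properties
  open import Data.Nat.DivMod
  open import Data.Nat.Divisibility
  open import Data.Nat.ListAction using (product)
  open import Data.Nat.Tactic.RingSolver using (solve-∀)
  open import Data.Nat.ListAction.Properties using (product-++)
  open import Data.List.Properties using (applyUpTo-∷ʳ)
  open import Relation.Nullary using (yes; no; does)
  open import Relation.Nullary.Decidable using (dec-true; dec-false)
  open Division
  open ≤-Reasoning

  ∑ : (ℕ → ℕ) → ℕ → ℕ
  ∑ f zero    = 0
  ∑ f (suc m) = ∑ f m + f (suc m)

  ∑-≤-+ : ∀ {f g h} → (∀ i → f i ≤ g i + h i) → ∀ m → ∑ f m ≤ ∑ g m + ∑ h m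
  ∑-≤-+         f≤g+h zero    = z≤n
  ∑-≤-+ {f} {g} {h} f≤g+h (suc m) = begin
    ∑ f m + f (suc m)                         ≤⟨ +-mono-≤ (∑-≤-+ f≤g+h m) (f≤g+h (suc m)) ⟩
    ∑ g m + ∑ h m + (g (suc m) + h (suc m))   ≡⟨ interchange (∑ g m) (∑ h m) (g (suc m)) (h (suc m)) ⟩
    ∑ g m + g (suc m) + (∑ h m + h (suc m))   ∎
    where
    interchange : ∀ a b x y → a + b + (x + y) ≡ a + x + (b + y)
    interchange = solve-∀

  module _ (k c : ℕ) where

    indicator : ℕ → ℕ
    indicator i = if does (i ≟ k) then c else 0

    indicator-≢ : ∀ {i} → i ≢ k → indicator i ≡ 0
    indicator-≢ {i} i≢k = cong (λ b → if b then c else 0) (dec-false (i ≟ k) i≢k)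

    ∑-indicator-< : ∀ m → m < k → ∑ indicator m ≡ 0
    ∑-indicator-< zero    _     = refl
    ∑-indicator-< (suc m) 1+m<k = begin-equality
      ∑ indicator m + indicator (suc m) ≡⟨ cong₂ _+_ (∑-indicator-< m (<-trans (n<1+n m) 1+m<k))
                                                     (indicator-≢ (<⇒≢ 1+m<k)) ⟩
      0 + 0                             ∎

    ∑-indicator-≤ : ∀ m → ∑ indicator m ≤ c
    ∑-indicator-≤ zero    = z≤n
    ∑-indicator-≤ (suc m) with suc m ≟ k
    ... | yes refl = ≤-reflexive (cong₂ _+_ (∑-indicator-< m ≤-refl)
                                            (cong (λ b → if b then c else 0) (dec-true (k ≟ k) refl)))
    ... | no  1+m≢k = begin
      ∑ indicator m + indicator (suc m) ≡⟨ cong (∑ indicator m +_) (indicator-≢ 1+m≢k) ⟩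
      ∑ indicator m + 0                 ≡⟨ +-identityʳ _ ⟩
      ∑ indicator m                     ≤⟨ ∑-indicator-≤ m ⟩
      c                                 ∎

  ∑-multiples : ∀ {d} .{{_ : NonZero d}} c m → ∑ (λ i → if does (d ∣? i) then c else 0) m ≡ m / d * c
  ∑-multiples {d} c zero    = cong (_* c) (sym (0/n≡0 d))
  ∑-multiples {d} c (suc m) with d ∣? suc m
  ... | yes d∣1+m = begin-equality
    ∑ _ m + c       ≡⟨ cong (_+ c) (∑-multiples c m) ⟩
    m / d * c + c   ≡⟨ +-comm (m / d * c) c ⟩
    suc (m / d) * c ≡⟨ cong (_* c) (suc-/-∣ m d∣1+m) ⟨
    suc m / d * c   ∎
  ... | no  d∤1+m = trans (+-identityʳ _)
                      (trans (∑-multiples c m) (cong (_* c) (sym (suc-/-∤ m d∤1+m))))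

  product-applyUpTo-suc : ∀ f n → product (applyUpTo f (suc n)) ≡ product (applyUpTo f n) * f n
  product-applyUpTo-suc f n = begin-equality
    product (applyUpTo f (suc n))               ≡⟨ cong product (applyUpTo-∷ʳ f n) ⟨
    product (applyUpTo f n ++ f n ∷ [])         ≡⟨ product-++ (applyUpTo f n) (f n ∷ []) ⟩
    product (applyUpTo f n) * (f n * 1)         ≡⟨ cong (product (applyUpTo f n) *_) (*-identityʳ (f n)) ⟩
    product (applyUpTo f n) * f n               ∎

  product-applyUpTo-^ : ∀ b f m → product (applyUpTo (λ i → b ^ f (suc i)) m) ≡ b ^ ∑ f m
  product-applyUpTo-^ b f zero    = refl
  product-applyUpTo-^ b f (suc m) = begin-equality
    product (applyUpTo (λ i → b ^ f (suc i)) (suc m))  ≡⟨ product-applyUpTo-suc _ m ⟩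
    product (applyUpTo (λ i → b ^ f (suc i)) m) * b ^ f (suc m)
      ≡⟨ cong (_* b ^ f (suc m)) (product-applyUpTo-^ b f m) ⟩
    b ^ ∑ f m * b ^ f (suc m)                          ≡⟨ ^-distribˡ-+-* b (∑ f m) (f (suc m)) ⟨
    b ^ ∑ f (suc m)                                    ∎

module PrimePowers where

  open import Data.Nat
  open import Data.Nat.Properties
  open import Data.Nat.Divisibility
  open import Data.Nat.Primality using (Prime; euclidsLemma; prime⇒nonZero; ¬prime[1])
  open import Data.Nat.Tactic.RingSolver using (solve-∀)
  open import Data.Sum using (inj₁; inj₂)
  open import Relation.Nullary using (¬_)

  prime∤1 : ∀ {p} → Prime p → ¬ p ∣ 1
  prime∤1 pr p∣1 = ¬prime[1] (subst Prime (∣1⇒≡1 p∣1) pr)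

  prime-∣-^ : ∀ {p} → Prime p → ∀ x e → p ∣ x ^ e → p ∣ x
  prime-∣-^ pr x zero    p∣1   = ⊥-elim (prime∤1 pr p∣1)
  prime-∣-^ pr x (suc e) p∣xxᵉ with euclidsLemma x (x ^ e) pr p∣xxᵉ
  ... | inj₁ p∣x  = p∣x
  ... | inj₂ p∣xᵉ = prime-∣-^ pr x e p∣xᵉ

  prime^-cancelʳ-∣ : ∀ {p} → Prime p → ∀ {y} → ¬ p ∣ y → ∀ e x → p ^ e ∣ x * y → p ^ e ∣ x
  prime^-cancelʳ-∣ pr p∤y zero    x _ = 1∣ x
  prime^-cancelʳ-∣ {p} pr {y} p∤y (suc e) x pᵉ⁺¹∣xy
    with euclidsLemma x y pr (m*n∣⇒m∣ p (p ^ e) pᵉ⁺¹∣xy)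
  ... | inj₂ p∣y = ⊥-elim (p∤y p∣y)
  ... | inj₁ (divides x′ refl) =
    subst (p * p ^ e ∣_) (*-comm p x′)
      (*-monoʳ-∣ p (prime^-cancelʳ-∣ pr p∤y e x′
        (*-cancelˡ-∣ p (subst (p * p ^ e ∣_) (regroup x′ p y) pᵉ⁺¹∣xy))))
    where
    instance _ = prime⇒nonZero pr
    regroup : ∀ a b c → a * b * c ≡ b * (a * c)
    regroup = solve-∀

  ^-monoʳ-∣ : ∀ b {m n} → m ≤ n → b ^ m ∣ b ^ n
  ^-monoʳ-∣ b {m} {n} m≤n = divides (b ^ (n ∸ m))
    (trans (cong (b ^_) (sym (m∸n+n≡m m≤n))) (^-distribˡ-+-* b (n ∸ m) m))

  ^-monoˡ-∣ : ∀ {a b} n → a ∣ b → a ^ n ∣ b ^ n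
  ^-monoˡ-∣ zero    a∣b = ∣-refl
  ^-monoˡ-∣ (suc n) a∣b = *-pres-∣ a∣b (^-monoˡ-∣ n a∣b)

  ^-∣⇒≤ : ∀ {b m n} → 1 < b → b ^ m ∣ b ^ n → m ≤ n
  ^-∣⇒≤ {b@(suc _)} {m} {n} 1<b bᵐ∣bⁿ =
    ≮⇒≥ (λ n<m → <⇒≱ (^-monoʳ-< b 1<b n<m) (∣⇒≤ {{m^n≢0 b n}} bᵐ∣bⁿ))

module Valuation (q : ℕ) where

  open import Data.Nat
  open import Data.Nat.Properties
  open import Data.Nat.DivMod
  open import Data.Nat.Divisibility
  open import Data.Nat.Induction using (<-rec)
  open import Data.Nat.Primality using (Prime)
  open import Data.Nat.Tactic.RingSolver using (solve-∀)
  open import Relation.Nullary using (¬_; yes; no; does)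
  open import Relation.Nullary.Decidable using (dec-true; dec-false)
  open Division
  open Sums
  open PrimePowers

  p : ℕ
  p = 2+ q

  -- Defs keeps the fuelled loop behind v private; unifying with the unfolding of v names it,
  -- so that its independence of the fuel can be proved.
  private
    mutual
      loop : ℕ → ℕ → ℕ
      loop = _

      loop-unfold : ∀ n → v p (suc n) ≡ (if does (p ∣? suc n) then suc (loop n (suc n / p)) else 0)
      loop-unfold n with suc n / p
      ... | _ = refl

    1<p : 1 < p
    1<p = s<s z<s

    /p-< : ∀ n → suc n / p < suc n
    /p-< n = m/n<m (suc n) p 1<p

    loop-zero : ∀ f → loop f 0 ≡ 0
    loop-zero zero    = refl
    loop-zero (suc f) = refl

    loop-fuel : ∀ {f g} n → n ≤ f → n ≤ g → loop f n ≡ loop g n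
    loop-fuel {f} {g} zero _ _ = trans (loop-zero f) (sym (loop-zero g))
    loop-fuel {suc f} {suc g} (suc n) (s≤s n≤f) (s≤s n≤g) =
      cong (λ e → if does (p ∣? suc n) then suc e else 0)
        (loop-fuel (suc n / p) (≤-trans (s≤s⁻¹ (/p-< n)) n≤f) (≤-trans (s≤s⁻¹ (/p-< n)) n≤g))

  v-∣ : ∀ {n} → p ∣ suc n → v p (suc n) ≡ suc (v p (suc n / p))
  v-∣ {n} p∣1+n = begin-equality
    v p (suc n)
      ≡⟨ loop-unfold n ⟩
    (if does (p ∣? suc n) then suc (loop n (suc n / p)) else 0)
      ≡⟨ cong (λ b → if b then suc (loop n (suc n / p)) else 0) (dec-true (p ∣? suc n) p∣1+n) ⟩
    suc (loop n (suc n / p))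
      ≡⟨ cong suc (loop-fuel (suc n / p) (s≤s⁻¹ (/p-< n)) ≤-refl) ⟩
    suc (v p (suc n / p)) ∎
    where open ≤-Reasoning

  v-∤ : ∀ {n} → ¬ p ∣ suc n → v p (suc n) ≡ 0
  v-∤ {n} p∤1+n = trans (loop-unfold n)
    (cong (λ b → if b then suc (loop n (suc n / p)) else 0) (dec-false (p ∣? suc n) p∤1+n))

  v-factor : ∀ n → 0 < n → ∃[ u ] ¬ p ∣ u × n ≡ u * p ^ v p n
  v-factor = <-rec (λ n → 0 < n → ∃[ u ] ¬ p ∣ u × n ≡ u * p ^ v p n) factor
    where
    factor : ∀ n → (∀ {m} → m < n → 0 < m → ∃[ u ] ¬ p ∣ u × m ≡ u * p ^ v p m) →
             0 < n → ∃[ u ] ¬ p ∣ u × n ≡ u * p ^ v p n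
    factor (suc r) rec _ with p ∣? suc r
    ... | no  p∤1+r = suc r , p∤1+r ,
      sym (trans (cong (λ e → suc r * p ^ e) (v-∤ p∤1+r)) (*-identityʳ (suc r)))
    ... | yes p∣1+r with rec (/p-< r) (m≥n⇒m/n>0 (∣⇒≤ p∣1+r))
    ...   | u , p∤u , eq = u , p∤u , (begin-equality
      suc r                         ≡⟨ m*[n/m]≡n p∣1+r ⟨
      p * (suc r / p)               ≡⟨ cong (p *_) eq ⟩
      p * (u * p ^ v p (suc r / p)) ≡⟨ swap p u (p ^ v p (suc r / p)) ⟩
      u * p ^ suc (v p (suc r / p)) ≡⟨ cong (λ e → u * p ^ e) (v-∣ p∣1+r) ⟨
      u * p ^ v p (suc r)           ∎)
      where
      open ≤-Reasoning
      swap : ∀ a b c → a * (b * c) ≡ b * (a * c)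
      swap = solve-∀

  ^v-∣ : ∀ {n} → 0 < n → p ^ v p n ∣ n
  ^v-∣ {n} n>0 with v-factor n n>0
  ... | u , _ , eq = divides u eq

  ∑v-/ : ∀ r → ∑ (v p) r ≡ r / p + ∑ (v p) (r / p)
  ∑v-/ zero    = refl
  ∑v-/ (suc r) with p ∣? suc r
  ... | yes p∣1+r = begin-equality
    ∑ (v p) r + v p (suc r)
      ≡⟨ cong₂ _+_ (∑v-/ r) (trans (v-∣ p∣1+r) (cong (suc ∘ v p) (suc-/-∣ r p∣1+r))) ⟩
    r / p + ∑ (v p) (r / p) + suc (v p (suc (r / p)))
      ≡⟨ shift (r / p) (∑ (v p) (r / p)) (v p (suc (r / p))) ⟩
    suc (r / p) + ∑ (v p) (suc (r / p))
      ≡⟨ cong (λ a → a + ∑ (v p) a) (suc-/-∣ r p∣1+r) ⟨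
    suc r / p + ∑ (v p) (suc r / p) ∎
    where
    open ≤-Reasoning
    shift : ∀ a s w → a + s + suc w ≡ suc a + (s + w)
    shift = solve-∀
  ... | no  p∤1+r = begin-equality
    ∑ (v p) r + v p (suc r)          ≡⟨ cong₂ _+_ (∑v-/ r) (v-∤ p∤1+r) ⟩
    r / p + ∑ (v p) (r / p) + 0      ≡⟨ +-identityʳ _ ⟩
    r / p + ∑ (v p) (r / p)          ≡⟨ cong (λ a → a + ∑ (v p) a) (suc-/-∤ r p∤1+r) ⟨
    suc r / p + ∑ (v p) (suc r / p)  ∎
    where open ≤-Reasoning

  ∑v-≤ : ∀ r → ∑ (v p) r ≤ r
  ∑v-≤ = <-rec (λ r → ∑ (v p) r ≤ r) bound
    where
    bound : ∀ r → (∀ {s} → s < r → ∑ (v p) s ≤ s) → ∑ (v p) r ≤ r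
    bound zero    _   = z≤n
    bound (suc r) rec = begin
      ∑ (v p) (suc r)                      ≡⟨ ∑v-/ (suc r) ⟩
      suc r / p + ∑ (v p) (suc r / p)      ≤⟨ +-monoʳ-≤ (suc r / p) (rec (/p-< r)) ⟩
      suc r / p + suc r / p                ≡⟨ double (suc r / p) ⟩
      suc r / p * 2                        ≤⟨ *-monoʳ-≤ (suc r / p) (s≤s (s≤s z≤n)) ⟩
      suc r / p * p                        ≤⟨ m/n*n≤m (suc r) p ⟩
      suc r                                ∎
      where
      open ≤-Reasoning
      double : ∀ a → a + a ≡ a * 2
      double = solve-∀

  module _ (prime : Prime p) where

    ^-∣-*-^v : ∀ {e x y} → 0 < y → p ^ e ∣ x * y → p ^ e ∣ x * p ^ v p y
    ^-∣-*-^v {e} {x} {y} y>0 pᵉ∣xy with v-factor y y>0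
    ... | u , p∤u , y≡ = prime^-cancelʳ-∣ prime p∤u e (x * p ^ v p y)
      (subst (p ^ e ∣_) (trans (cong (x *_) y≡) (regroup x u (p ^ v p y))) pᵉ∣xy)
      where
      regroup : ∀ a b c → a * (b * c) ≡ a * c * b
      regroup = solve-∀

    v-*-≤ : ∀ {x y} → 0 < x → 0 < y → v p (x * y) ≤ v p x + v p y
    v-*-≤ {x} {y} x>0 y>0 = ^-∣⇒≤ 1<p (subst (p ^ v p (x * y) ∣_) powers pᵛ∣pᵛʸpᵛˣ)
      where
      pᵛ∣pᵛʸx : p ^ v p (x * y) ∣ p ^ v p y * x
      pᵛ∣pᵛʸx = subst (p ^ v p (x * y) ∣_) (*-comm x (p ^ v p y))
                  (^-∣-*-^v {v p (x * y)} {x} y>0 (^v-∣ (*-mono-< x>0 y>0)))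
      pᵛ∣pᵛʸpᵛˣ : p ^ v p (x * y) ∣ p ^ v p y * p ^ v p x
      pᵛ∣pᵛʸpᵛˣ = ^-∣-*-^v {v p (x * y)} {p ^ v p y} x>0 pᵛ∣pᵛʸx
      powers : p ^ v p y * p ^ v p x ≡ p ^ (v p x + v p y)
      powers = trans (*-comm (p ^ v p y) (p ^ v p x)) (sym (^-distribˡ-+-* p (v p x) (v p y)))

    v-!-suc-≤ : ∀ n → v p (suc n !) ≤ v p (n !) + v p (suc n)
    v-!-suc-≤ n = ≤-trans (v-*-≤ {suc n} {n !} z<s (1≤n! n)) (≤-reflexive (+-comm (v p (suc n)) (v p (n !))))

    v-!-≤ : ∀ n → v p (n !) ≤ n
    v-!-≤ n = ≤-trans (v-!-≤-∑ n) (∑v-≤ n)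
      where
      v-!-≤-∑ : ∀ n → v p (n !) ≤ ∑ (v p) n
      v-!-≤-∑ zero    = ≤-reflexive (v-∤ (prime∤1 prime))
      v-!-≤-∑ (suc n) = ≤-trans (v-!-suc-≤ n) (+-monoˡ-≤ (v p (suc n)) (v-!-≤-∑ n))

module PrimePowerProducts where

  open import Data.Nat
  open import Data.Nat.Properties
  open import Data.Nat.Divisibility
  open import Data.Nat.ListAction using (product)
  open import Data.Nat.Primality using (Prime; prime?; prime[2]; euclidsLemma; prime⇒nonZero)
  open import Data.List.Properties using (map-upTo; map-cong)
  open import Data.Sum using (inj₁; inj₂)
  open import Relation.Nullary using (¬_; Dec; yes; no; does)
  open Sums using (product-applyUpTo-suc)
  open PrimePowers

  primePower : (ℕ → ℕ) → ℕ → ℕ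
  primePower e n = if does (prime? n) then n ^ e n else 1

  prime∤product-primePower : ∀ {p} → Prime p → ∀ e n → n ≤ p →
    ¬ p ∣ product (applyUpTo (primePower e) n)
  prime∤product-primePower pr e zero    _     = prime∤1 pr
  prime∤product-primePower {p} pr e (suc n) 1+n≤p p∣Pf
    with euclidsLemma _ _ pr (subst (p ∣_) (product-applyUpTo-suc (primePower e) n) p∣Pf)
  ... | inj₁ p∣P = prime∤product-primePower pr e n (≤-trans (n≤1+n n) 1+n≤p) p∣P
  ... | inj₂ p∣f = ∤primePower (prime? n) p∣f
    where
    ∤primePower : (d : Dec (Prime n)) → ¬ p ∣ (if does d then n ^ e n else 1)
    ∤primePower (yes prime-n) p∣nᵉ =
      <⇒≱ 1+n≤p (∣⇒≤ {{prime⇒nonZero prime-n}} (prime-∣-^ pr n (e n) p∣nᵉ))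
    ∤primePower (no _) = prime∤1 pr

  product-primePower-∣ : ∀ e {x} → (∀ p → Prime p → p ^ e p ∣ x) →
    ∀ n → product (applyUpTo (primePower e) n) ∣ x
  product-primePower-∣ e {x} pᵉ∣x zero    = 1∣ x
  product-primePower-∣ e {x} pᵉ∣x (suc n) =
    subst (_∣ x) (sym (product-applyUpTo-suc (primePower e) n)) (extend (prime? n))
    where
    P = product (applyUpTo (primePower e) n)
    P∣x : P ∣ x
    P∣x = product-primePower-∣ e pᵉ∣x n
    extend : (d : Dec (Prime n)) → P * (if does d then n ^ e n else 1) ∣ x
    extend (no _)        = subst (_∣ x) (sym (*-identityʳ P)) P∣x
    extend (yes prime-n) with P∣x
    ... | divides y x≡yP = subst (P * n ^ e n ∣_) (trans (*-comm P y) (sym x≡yP))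
      (*-monoʳ-∣ P (prime^-cancelʳ-∣ prime-n (prime∤product-primePower prime-n e n ≤-refl) (e n) y
        (subst (n ^ e n ∣_) x≡yP (pᵉ∣x n prime-n))))

  *-product-primePower-∣ : ∀ a .{{_ : NonZero a}} e {x} f → (∀ n → f n ≡ primePower e n) →
    (∀ p → Prime p → a * p ^ e p ∣ x) → ∀ n → a * product (map f (upTo n)) ∣ x
  *-product-primePower-∣ a e {x} f f≗ apᵉ∣x n with m*n∣⇒m∣ a (2 ^ e 2) (apᵉ∣x 2 prime[2])
  ... | divides y x≡ya = subst (a * product (map f (upTo n)) ∣_) (trans (*-comm a y) (sym x≡ya))
    (*-monoʳ-∣ a (subst (_∣ y) (cong product (sym f-product)) (product-primePower-∣ e pᵉ∣y n)))
    where
    f-product : map f (upTo n) ≡ applyUpTo (primePower e) n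
    f-product = trans (map-cong f≗ (upTo n)) (map-upTo (primePower e) n)
    pᵉ∣y : ∀ p → Prime p → p ^ e p ∣ y
    pᵉ∣y p prime-p = *-cancelˡ-∣ a (subst (a * p ^ e p ∣_) (trans x≡ya (*-comm y a)) (apᵉ∣x p prime-p))

module BstarNumerator (m l : ℕ) where

  open import Data.Integer as ℤ using (+_; -_)
  open import Data.Integer.Properties using (+-identityʳ)
  open import Data.Integer.Divisibility.Signed using (∣⇒∣ᵤ)
  open import Data.Nat
  open import Data.Nat.Properties hiding (+-identityʳ)
  open import Data.Nat.DivMod using (_/_)
  open import Data.Nat.Divisibility
  open import Data.Nat.ListAction using (product)
  open import Data.Nat.Primality using (Prime; ¬prime[0]; ¬prime[1])
  open import Data.List.Properties using (map-applyUpTo)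
  open import Relation.Nullary using (Dec; yes; no; does)
  open Polynomials
  open HurwitzDivisibility
  open Sums
  open PrimePowers
  open PrimePowerProducts

  exponent : ℕ → ℕ
  exponent zero    = 0
  exponent (suc n) = (m / suc n * v (suc n) (l !)) ∸ v (suc n) l

  primeFactor≗primePower : ∀ n → primeFactor m l n ≡ primePower exponent n
  primeFactor≗primePower zero    = refl
  primeFactor≗primePower (suc n) = refl

  module _ (k : ℕ) where

    factor : ℕ → Poly
    factor i = powP ((+ i ℤ.- + 0) ∷ - + 1 ∷ []) (lk l k i)

    lk₀!∣ʰfactor₀ : lk l k 0 ! ∣ʰ coeff (factor 0)
    lk₀!∣ʰfactor₀ = ∣ʰ-linPow 0 _! n!∣0ⁿ (λ _ → ∣-refl) (lk l k 0)
      where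
      n!∣0ⁿ : ∀ n → n ! ∣ 0 ^ n
      n!∣0ⁿ zero    = ∣-refl
      n!∣0ⁿ (suc n) = (suc n !) ∣0

    [l∸1]!∣lk₀! : (l ∸ 1) ! ∣ lk l k 0 !
    [l∸1]!∣lk₀! = by-cases (0 ≟ k)
      where
      by-cases : (e : Dec (0 ≡ k)) → (l ∸ 1) ! ∣ (if does e then l ∸ 1 else l) !
      by-cases (yes _) = ∣-refl
      by-cases (no  _) = m≤n⇒m!∣n! (m∸n≤m l 1)

    module AtPrime (q : ℕ) (prime : Prime (2+ q)) where

      open Valuation q

      ^v!∣ʰlinPow : ∀ {b} → p ∣ b → ∀ n → p ^ v p (n !) ∣ʰ coeff (powP (lin (+ b)) n)
      ^v!∣ʰlinPow {b} p∣b = ∣ʰ-linPow b (λ n → p ^ v p (n !))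
        (λ n → ∣-trans (^-monoʳ-∣ p (v-!-≤ prime n)) (^-monoˡ-∣ n p∣b))
        (λ n → ^-∣-*-^v prime {v p (suc n !)} {suc n} (1≤n! n) (^v-∣ (1≤n! (suc n))))

      exponentAt : ℕ → ℕ
      exponentAt i = if does (p ∣? i) then v p (lk l k i !) else 0

      weight : ℕ → ℕ
      weight zero    = lk l k 0 !
      weight (suc i) = p ^ exponentAt (suc i)

      weight-∣ʰ-factor : ∀ i → weight i ∣ʰ coeff (factor i)
      weight-∣ʰ-factor zero    = lk₀!∣ʰfactor₀
      weight-∣ʰ-factor (suc i) = by-cases (p ∣? suc i)
        where
        n = lk l k (suc i)
        by-cases : (d : Dec (p ∣ suc i)) → p ^ (if does d then v p (n !) else 0) ∣ʰ coeff (factor (suc i))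
        by-cases (yes p∣1+i) = subst (λ b → p ^ v p (n !) ∣ʰ coeff (powP (lin b) n))
                                 (sym (+-identityʳ (+ suc i))) (^v!∣ʰlinPow p∣1+i n)
        by-cases (no  _)     = 1∣ʰ _

      product-weight : product (map weight (upTo (suc m))) ≡ lk l k 0 ! * p ^ ∑ exponentAt m
      product-weight = cong (lk l k 0 ! *_)
        (trans (cong product (map-applyUpTo suc weight m)) (product-applyUpTo-^ p exponentAt m))

      exponent-≤ : 1 ≤ l → (m / p * v p (l !)) ∸ v p l ≤ ∑ exponentAt m
      exponent-≤ l≥1 = m≤n+o⇒m∸n≤o (m / p * v p (l !)) (v p l) (begin
        m / p * v p (l !)                                    ≡⟨ ∑-multiples (v p (l !)) m ⟨
        ∑ (λ i → if does (p ∣? i) then v p (l !) else 0) m   ≤⟨ ∑-≤-+ pointwise m ⟩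
        ∑ exponentAt m + ∑ (indicator k (v p l)) m           ≤⟨ +-monoʳ-≤ (∑ exponentAt m) (∑-indicator-≤ k (v p l) m) ⟩
        ∑ exponentAt m + v p l                               ≡⟨ +-comm (∑ exponentAt m) (v p l) ⟩
        v p l + ∑ exponentAt m                               ∎)
        where
        open ≤-Reasoning
        v-n! : ∀ n → 1 ≤ n → v p (n !) ≤ v p ((n ∸ 1) !) + v p n
        v-n! (suc n) _ = v-!-suc-≤ prime n
        pointwise : ∀ i → (if does (p ∣? i) then v p (l !) else 0) ≤ exponentAt i + indicator k (v p l) i
        pointwise i = by-cases (p ∣? i) (i ≟ k)
          where
          by-cases : (d : Dec (p ∣ i)) (e : Dec (i ≡ k)) →
            (if does d then v p (l !) else 0) ≤
            (if does d then v p ((if does e then l ∸ 1 else l) !) else 0) + (if does e then v p l else 0)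
          by-cases (no  _) _       = z≤n
          by-cases (yes _) (no  _) = m≤m+n (v p (l !)) 0
          by-cases (yes _) (yes _) = v-n! l l≥1

      prime-part : 1 ≤ l → ∀ i →
        (l ∸ 1) ! * p ^ ((m / p * v p (l !)) ∸ v p l) ∣ ℤ.∣ BstarNum m l k 0 i ∣
      prime-part l≥1 i = ∣-trans (*-pres-∣ [l∸1]!∣lk₀! (^-monoʳ-∣ p (exponent-≤ l≥1)))
        (subst (_∣ ℤ.∣ BstarNum m l k 0 i ∣) product-weight
          (∣⇒∣ᵤ (∣ʰ-product weight factor weight-∣ʰ-factor (upTo (suc m)) i)))

    prime-part : 1 ≤ l → ∀ i p → Prime p → (l ∸ 1) ! * p ^ exponent p ∣ ℤ.∣ BstarNum m l k 0 i ∣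
    prime-part l≥1 i 0      p-prime = ⊥-elim (¬prime[0] p-prime)
    prime-part l≥1 i 1      p-prime = ⊥-elim (¬prime[1] p-prime)
    prime-part l≥1 i (2+ q) p-prime = AtPrime.prime-part q p-prime l≥1 i

open import Data.Nat using (_≤_; _∸_; _*_)
open import Data.Nat.Properties using (_!≢0)
open import Data.Integer using (+_)
open import Data.Integer.Divisibility using (_∣_)
open PrimePowerProducts using (*-product-primePower-∣)
open BstarNumerator using (exponent; primeFactor≗primePower; prime-part)

theorem6p1 : (m l k : ℕ) → 1 ≤ m → 1 ≤ l → k ≤ m →
    (i : ℕ) → i ≤ L m l →
    (+ ((l ∸ 1) ! * primeProduct m l)) ∣ BstarNum m l k 0 i
theorem6p1 m l k _ l≥1 _ i _ =
  *-product-primePower-∣ ((l ∸ 1) !) {{(l ∸ 1) !≢0}} (exponent m l) (primeFactor m l)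
    (primeFactor≗primePower m l) (prime-part m l k l≥1 i) (suc m)
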